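{- Let $d\in\mathbb{N}$, $n_1,\dots,n_d\in\mathbb{N}$ and $X=[n_1]\times\cdots\times[n_d]$. Every permutation $\sigma:X\to X$ can be expressed as $\sigma=\sigma_1\circ\cdots\circ\sigma_{2d-1}$ where $\sigma_1,\dots,\sigma_{2d-1}$ are one-dimensional permutations of $X$. Moreover, if $n_1,\dots,n_d\ge 2$, there exists a permutation $\sigma:X\to X$ such that any expression of $\sigma$ as a composition of one-dimensional permutations uses at least $2d-1$ permutations.
   Context: $[n]=\{1,\dots,n\}$. A permutation $\tau:X\to X$ is one-dimensional if there exists an index $i\in[d]$ such that for every $x\in X$, the points $x$ and $\tau(x)$ agree in all coordinates except possibly the $i$-th. -}

module Defs where

open import Level using (0ℓ)
open import Data.Nat using (ℕ)
open import Data.Fin using (Fin)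
open import Data.Product using (∃-syntax; Σ-syntax; _×_)
open import Data.Vec using (Vec; []; _∷_; map)
open import Data.Vec.Relation.Unary.All using (All)
open import Function using (_∘_; id)
open import Function.Bundles using (Inverse)
open import Relation.Binary.Bundles using (Setoid)
open import Relation.Binary.PropositionalEquality using (_≡_; _≢_; refl; sym; trans)

-- The grid X = [n₁] × ⋯ × [n_d], with [m] modelled as Fin m.
Grid : (d : ℕ) → (Fin d → ℕ) → Set
Grid d n = (i : Fin d) → Fin (n i)

_≈G_ : ∀ {d n} → Grid d n → Grid d n → Set
x ≈G y = ∀ i → x i ≡ y i

GridSetoid : (d : ℕ) → (Fin d → ℕ) → Setoid 0ℓ 0ℓ
GridSetoid d n = record
  { Carrier = Grid d n
  ; _≈_ = _≈G_
  ; isEquivalence = record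
    { refl = λ i → refl
    ; sym = λ p i → sym (p i)
    ; trans = λ p q i → trans (p i) (q i)
    }
  }

Perm : (d : ℕ) → (Fin d → ℕ) → Set
Perm d n = Inverse (GridSetoid d n) (GridSetoid d n)

OneDim : ∀ {d n} → Perm d n → Set
OneDim {d} {n} τ = ∃[ i ] ∀ (x : Grid d n) (j : Fin d) → j ≢ i → Inverse.to τ x j ≡ x j

composeAll : ∀ {A : Set} {k : ℕ} → Vec (A → A) k → A → A
composeAll [] = id
composeAll (f ∷ fs) = f ∘ composeAll fs

OneDimDecomposition : ∀ {d n} → ℕ → Perm d n → Set
OneDimDecomposition {d} {n} k σ =
  Σ[ τs ∈ Vec (Perm d n) k ]
    (All OneDim τs × (∀ x → Inverse.to σ x ≈G composeAll (map Inverse.to τs) x))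

{-# OPTIONS --safe #-}
-- Write X = [n₁] × X′. The points (a , y) with a fixed tail y form a column, and a permutation σ
-- of X is read as a bipartite multigraph on two copies of the set of columns: the point (a , y)
-- is an edge from the column of y to the column of the tail of σ (a , y). Every column has n₁
-- points, so this multigraph is n₁-regular, and by Kőnig's edge-colouring theorem (a Kempe-chain
-- argument) it has a proper edge colouring with n₁ colours. Reading the colour of a point
-- as a new first coordinate factors σ into three steps: permute each column (point ↦ its colour),
-- move each colour class between columns (this fixes the first coordinate), and permute each
-- column into place. Hence σ = A ∘ M ∘ B where A and B move only the first coordinate and M
-- permutes every slice {x₁ = b} separately. By induction each slice permutation of M is a product
-- of 2d − 3 one-dimensional permutations along one common sequence of coordinates, so the slices
-- can be moved in lockstep, and σ is a product of 2d − 1 one-dimensional permutations.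
--
-- For the lower bound let σ swap z = (0, …, 0) and o = (1, …, 1). A product of at most 2d − 2
-- one-dimensional permutations splits as U ∘ V where both halves have fewer than d factors, so U
-- fixes some coordinate j and V some coordinate i. Then V maps the finite set of points y with
-- y i = 0 and (σ y) j = 1 injectively into itself without z, which is impossible.
--
-- Membership in a Kempe chain is not decidable a priori, so the colouring is built under double
-- negation; the double negation is then removed because having an edge colouring is decidable.

module Submission where

open import Defs
open import Data.Nat using (ℕ; zero; suc; _+_; _*_; _∸_; _≤_; _<_; z≤n; s≤s; s≤s⁻¹)
open import Data.Nat.Properties
  using (1+n≰n; <⇒≱; +-suc; +-identityʳ; ≤-trans; ≮⇒≥; m⊓n≤m; m⊓n+n∸m≡n; m≤n+o⇒m∸n≤o; 0≢1+n)
open import Data.Fin using (Fin; zero; suc; punchOut; toℕ; fromℕ<; combine; remQuot)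
open import Data.Fin.Properties
  using (any?; all?; ¬∀⟶∃¬; injective⇒≤; punchOut-injective; _≟_; toℕ-fromℕ<; remQuot-combine; *↔×)
open import Data.Fin.Permutation as Permutation
  using (Permutation′; permutation; _⟨$⟩ʳ_; _⟨$⟩ˡ_; inverseˡ; inverseʳ)
open import Data.Fin.Permutation.Components using (transpose; transpose-inverse)
open import Data.Bool using (if_then_else_)
open import Data.Empty using (⊥)
open import Data.List using (List; []; _∷_; allFin; cartesianProduct)
open import Data.List.Membership.Propositional.Properties using (∈-cartesianProduct⁺; ∈-allFin)
import Data.List.Relation.Unary.All as ListAll
open import Data.Maybe as Maybe using (Maybe; just; nothing)
open import Data.Maybe.Properties using (just-injective) renaming (≡-dec to ≡-dec-Maybe)
open import Data.Product using (∃; Σ-syntax; _×_; _,_; proj₁; proj₂; map₂; uncurry)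
open import Data.Product.Properties using () renaming (≡-dec to ≡-dec-×)
open import Data.Sum using (_⊎_; inj₁; inj₂)
open import Data.Vec using (Vec; []; _∷_; _∷ʳ_; _++_; map; head; tail; lookup; tabulate; splitAt)
open import Data.Vec.Properties using (lookup∘tabulate)
open import Data.Vec.Relation.Unary.All using (All; []; _∷_)
open import Data.Vec.Relation.Unary.All.Properties using (lookup⁺; lookup⁻; ++ˡ⁻; ++ʳ⁻)
open import Data.Vec.Relation.Binary.Pointwise.Inductive using (Pointwise; []; _∷_)
open import Effect.Monad using (RawMonad)
open import Function using (_∘_; const; _↔_; Inverse; Injection; mk↔ₛ′)
open import Function.Definitions using (Injective; Congruent; StrictlyInverseˡ; StrictlyInverseʳ)
open import Function.Properties.Inverse using (Inverse⇒Injection)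
import Function.Consequences.Setoid as Consequences
import Function.Construct.Composition as Compose
import Function.Construct.Symmetry as Symmetry
open import Level using (Level; 0ℓ)
open import Relation.Binary.Bundles using (Setoid)
open import Relation.Binary.PropositionalEquality as ≡
  using (_≡_; _≢_; _≗_; refl; sym; trans; cong; cong₂; subst; module ≡-Reasoning)
import Relation.Binary.Reasoning.Setoid as SetoidReasoning
open import Relation.Nullary using (¬_; Dec; yes; no; does; contradiction; map′; _×-dec_; _→-dec_)
open import Relation.Nullary.Decidable using (¬¬-excluded-middle; decidable-stable)
open import Relation.Nullary.Negation using (¬¬-Monad)
open import Relation.Unary using (Decidable)

open RawMonad (¬¬-Monad {0ℓ})

private variable
  a ℓ : Level

-- Finite sets

injective⇒surjective : ∀ {m} {f : Fin m → Fin m} → Injective _≡_ _≡_ f → ∀ t → ∃ λ a → f a ≡ t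
injective⇒surjective {suc m} {f} f-injective t with any? (λ a → f a ≟ t)
... | yes hit = hit
... | no miss = contradiction (injective⇒≤ punchOut∘f-injective) 1+n≰n
  where
  t≢f : ∀ a → t ≢ f a
  t≢f a t≡fa = miss (a , sym t≡fa)
  punchOut∘f-injective : Injective _≡_ _≡_ (λ a → punchOut (t≢f a))
  punchOut∘f-injective eq = f-injective (punchOut-injective (t≢f _) (t≢f _) eq)

injective⇒permutation : ∀ {m} (f : Fin m → Fin m) → Injective _≡_ _≡_ f → Permutation′ m
injective⇒permutation f f-injective =
  permutation f (proj₁ ∘ surjective) (proj₂ ∘ surjective) (λ a → f-injective (proj₂ (surjective (f a))))
  where
  surjective : ∀ t → ∃ λ a → f a ≡ t
  surjective = injective⇒surjective f-injective

partial⇒∃-unhit : ∀ {m} (g : Fin m → Maybe (Fin m)) {s} → g s ≡ nothing →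
                  ∃ λ γ → ∀ a → g a ≢ just γ
partial⇒∃-unhit g {s} g[s]≡nothing = map₂ (λ unhit a eq → unhit (a , eq))
  (¬∀⟶∃¬ _ _ (λ γ → any? λ a → ≡-dec-Maybe _≟_ (g a) (just γ)) ¬allHit)
  where
  preimage-injective : (hit : ∀ γ → ∃ λ a → g a ≡ just γ) → Injective _≡_ _≡_ (proj₁ ∘ hit)
  preimage-injective hit {γ} {γ′} eq =
    just-injective (trans (sym (proj₂ (hit γ))) (trans (cong g eq) (proj₂ (hit γ′))))
  ¬allHit : ¬ (∀ γ → ∃ λ a → g a ≡ just γ)
  ¬allHit hit with injective⇒surjective (preimage-injective hit) s
  ... | γ , refl = contradiction (trans (sym (proj₂ (hit γ))) g[s]≡nothing) λ ()

<⇒∃-unhit : ∀ {L d} → L < d → (f : Fin L → Fin d) → ∃ λ j → ∀ t → f t ≢ j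
<⇒∃-unhit L<d f = map₂ (λ unhit t eq → unhit (t , eq))
  (¬∀⟶∃¬ _ _ (λ j → any? λ t → f t ≟ j) ¬allHit)
  where
  ¬allHit : ¬ (∀ j → ∃ λ t → f t ≡ j)
  ¬allHit hit = <⇒≱ L<d (injective⇒≤ λ {j} {j′} eq →
    trans (sym (proj₂ (hit j))) (trans (cong f eq) (proj₂ (hit j′))))

¬¬-∀-Fin : ∀ {n} {P : Fin n → Set} → (∀ i → ¬ ¬ P i) → ¬ ¬ (∀ i → P i)
¬¬-∀-Fin {zero}  _   = pure λ ()
¬¬-∀-Fin {suc n} ¬¬P = do
  p₀ ← ¬¬P zero
  ps ← ¬¬-∀-Fin (¬¬P ∘ suc)
  pure λ { zero → p₀ ; (suc i) → ps i }

∃-Vec? : ∀ {m} N {P : Vec (Fin m) N → Set} → Decidable P → Dec (∃ P)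
∃-Vec? zero    P? = map′ ([] ,_) (λ { ([] , p) → p }) (P? [])
∃-Vec? (suc N) P? =
  map′ (λ (a , v , p) → a ∷ v , p) (λ { (a ∷ v , p) → a , v , p }) (any? λ a → ∃-Vec? N (P? ∘ (a ∷_)))

Pointwise-uncons : ∀ {A B : Set} {R : A → B → Set} {L a} {as : Vec A L} (bs : Vec B (suc L)) →
                   Pointwise R (a ∷ as) bs → R a (head bs) × Pointwise R as (tail bs)
Pointwise-uncons (b ∷ bs) (r ∷ rs) = r , rs

Pointwise-∷ʳ : ∀ {A B : Set} {R : A → B → Set} {L a b} {as : Vec A L} {bs : Vec B L} →
               Pointwise R as bs → R a b → Pointwise R (as ∷ʳ a) (bs ∷ʳ b)
Pointwise-∷ʳ []        r = r ∷ []
Pointwise-∷ʳ (r′ ∷ rs) r = r′ ∷ Pointwise-∷ʳ rs r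

transpose-matchˡ : ∀ {n} (i j : Fin n) → transpose i j i ≡ j
transpose-matchˡ i j with i ≟ i
... | yes _  = refl
... | no i≢i = contradiction refl i≢i

transpose-matchʳ : ∀ {n} (i j : Fin n) → transpose i j j ≡ i
transpose-matchʳ i j with j ≟ i
... | yes j≡i = j≡i
... | no _ with j ≟ j
...   | yes _  = refl
...   | no j≢j = contradiction refl j≢j

transpose-other : ∀ {n} {i j k : Fin n} → k ≢ i → k ≢ j → transpose i j k ≡ k
transpose-other {i = i} {j} {k} k≢i k≢j with k ≟ i
... | yes k≡i = contradiction k≡i k≢i
... | no _ with k ≟ j
...   | yes k≡j = contradiction k≡j k≢j
...   | no _    = refl

-- Permutations of setoids

mkInverse : ∀ {S T : Setoid a ℓ}
            (to : Setoid.Carrier S → Setoid.Carrier T) (from : Setoid.Carrier T → Setoid.Carrier S) →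
            Congruent (Setoid._≈_ S) (Setoid._≈_ T) to → Congruent (Setoid._≈_ T) (Setoid._≈_ S) from →
            StrictlyInverseˡ (Setoid._≈_ T) to from → StrictlyInverseʳ (Setoid._≈_ S) to from → Inverse S T
mkInverse {S = S} {T} to from to-cong from-cong invˡ invʳ = record
  { to = to ; from = from ; to-cong = to-cong ; from-cong = from-cong
  ; inverse = strictlyInverseˡ⇒inverseˡ to-cong invˡ , strictlyInverseʳ⇒inverseʳ from-cong invʳ }
  where open Consequences S T

conjugate : ∀ {S T : Setoid a ℓ} → Inverse S T → Inverse T T → Inverse S S
conjugate e π = Compose.inverse e (Compose.inverse π (Symmetry.inverse e))

finite-injective⇒surjective : ∀ {S : Setoid a ℓ} {N} → Inverse S (≡.setoid (Fin N)) →
                              ∀ {f : Setoid.Carrier S → Setoid.Carrier S} →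
                              Injective (Setoid._≈_ S) (Setoid._≈_ S) f → ∀ y → ∃ λ x → Setoid._≈_ S (f x) y
finite-injective⇒surjective {S = S} c {f} f-injective y =
  let a , coded-f[a]≡y = injective⇒surjective coded-f-injective (to y) in from a , to-injective coded-f[a]≡y
  where
  open Inverse c
  to-injective : Injective (Setoid._≈_ S) _≡_ to
  to-injective = Injection.injective (Inverse⇒Injection c)
  coded-f-injective : Injective _≡_ _≡_ (to ∘ f ∘ from)
  coded-f-injective {a} {b} eq =
    trans (sym (strictlyInverseˡ a)) (trans (to-cong (f-injective (to-injective eq))) (strictlyInverseˡ b))

-- Kőnig's edge-colouring theorem

columnwise : ∀ {m k} → (Fin k → Permutation′ m) → Fin m × Fin k → Fin m × Fin k
columnwise π (a , i) = π i ⟨$⟩ʳ a , i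

rowwise : ∀ {m k} → (Fin m → Permutation′ k) → Fin m × Fin k → Fin m × Fin k
rowwise π (b , i) = b , π b ⟨$⟩ʳ i

columnwise↔ : ∀ {m k} → (Fin k → Permutation′ m) → (Fin m × Fin k) ↔ (Fin m × Fin k)
columnwise↔ π = mk↔ₛ′ (columnwise π) (columnwise (Permutation.flip ∘ π))
  (λ (a , i) → cong (_, i) (inverseʳ (π i))) (λ (a , i) → cong (_, i) (inverseˡ (π i)))

record ColumnRowColumn {m k} (σ : Fin m × Fin k → Fin m × Fin k) : Set where
  field
    first  : Fin k → Permutation′ m
    middle : Fin m → Permutation′ k
    last   : Fin k → Permutation′ m
    factorises : ∀ p → σ p ≡ columnwise last (rowwise middle (columnwise first p))

-- Every p : Fin m × Fin k is an edge, from column src p to column tgt p, of an m-regular bipartite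
-- multigraph.
module Kőnig {m k} (σ : (Fin m × Fin k) ↔ (Fin m × Fin k)) where

  open Inverse σ using (to; from; strictlyInverseʳ)

  Edge : Set
  Edge = Fin m × Fin k

  _≟ₑ_ : (p q : Edge) → Dec (p ≡ q)
  _≟ₑ_ = ≡-dec-× _≟_ _≟_

  src tgt : Edge → Fin k
  src = proj₂
  tgt = proj₂ ∘ to

  Colouring : Set
  Colouring = Edge → Maybe (Fin m)

  ProperAt : (Edge → Fin k) → Colouring → Set
  ProperAt end c = ∀ {p q γ} → end p ≡ end q → c p ≡ just γ → c q ≡ just γ → p ≡ q

  Proper : Colouring → Set
  Proper c = ProperAt src c × ProperAt tgt c

  Coloured : Colouring → Edge → Set
  Coloured c p = ∃ λ γ → c p ≡ just γ

  _⊑_ : Colouring → Colouring → Set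
  c ⊑ c′ = ∀ p → Coloured c p → Coloured c′ p

  ⊑-refl : ∀ {c} → c ⊑ c
  ⊑-refl _ coloured = coloured

  uncoloured : Colouring
  uncoloured = const nothing

  uncoloured-proper : Proper uncoloured
  uncoloured-proper = (λ _ ()) , (λ _ ())

  freeAtSrc : ∀ {c : Colouring} {e} → c e ≡ nothing → ∃ λ α → ∀ p → src p ≡ src e → c p ≢ just α
  freeAtSrc {c} {e = a , i} ce≡nothing =
    map₂ unused⇒free (partial⇒∃-unhit (λ b → c (b , i)) {a} ce≡nothing)
    where
    unused⇒free : ∀ {α} → (∀ a → c (a , i) ≢ just α) → ∀ p → src p ≡ i → c p ≢ just α
    unused⇒free unused (a , _) refl = unused a

  freeAtTgt : ∀ {c : Colouring} {e} → c e ≡ nothing → ∃ λ β → ∀ p → tgt p ≡ tgt e → c p ≢ just β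
  freeAtTgt {c} {e} ce≡nothing =
    map₂ unused⇒free (partial⇒∃-unhit (λ b → c (from (b , tgt e))) {proj₁ (to e)} c[from[to[e]]]≡nothing)
    where
    c[from[to[e]]]≡nothing : c (from (to e)) ≡ nothing
    c[from[to[e]]]≡nothing = trans (cong c (strictlyInverseʳ e)) ce≡nothing
    unused⇒free : ∀ {β} → (∀ b → c (from (b , tgt e)) ≢ just β) → ∀ p → tgt p ≡ tgt e → c p ≢ just β
    unused⇒free unused p tp≡te cp≡β =
      unused (proj₁ (to p)) (trans (cong (λ j → c (from (proj₁ (to p) , j))) (sym tp≡te))
                                   (trans (cong c (strictlyInverseʳ p)) cp≡β))

  _[_≔_] : Colouring → Edge → Fin m → Colouring
  (c [ e ≔ γ ]) p = if does (p ≟ₑ e) then just γ else c p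

  update-properAt : ∀ {end} {c : Colouring} {e γ} → ProperAt end c →
                    (∀ q → end q ≡ end e → c q ≢ just γ) → ProperAt end (c [ e ≔ γ ])
  update-properAt {e = e} proper γ-unused {p} {q} ep≡eq cp cq with p ≟ₑ e | q ≟ₑ e
  ... | yes refl | yes refl = refl
  ... | yes refl | no _     = contradiction (trans cq (sym cp)) (γ-unused q (sym ep≡eq))
  ... | no _     | yes refl = contradiction (trans cp (sym cq)) (γ-unused p ep≡eq)
  ... | no _     | no _     = proper ep≡eq cp cq

  update-coloured : ∀ c e γ → Coloured (c [ e ≔ γ ]) e
  update-coloured c e γ with e ≟ₑ e
  ... | yes _  = γ , refl
  ... | no e≢e = contradiction refl e≢e

  ⊑-update : ∀ c e γ → c ⊑ (c [ e ≔ γ ])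
  ⊑-update c e γ p cp with p ≟ₑ e
  ... | yes _ = γ , refl
  ... | no _  = cp

  module Recolour (c : Colouring) (α β : Fin m) where

    ColouredIn : Edge → Set
    ColouredIn p = c p ≡ just α ⊎ c p ≡ just β

    ClosedAt : (Edge → Fin k) → (Edge → Set) → Set
    ClosedAt end S = ∀ {p q} → S p → end p ≡ end q → q ≢ p → ColouredIn q → S q

    module Swap {S : Edge → Set} (S? : Decidable S) where

      swapped : Colouring
      swapped p = if does (S? p) then Maybe.map (transpose α β) (c p) else c p

      swapped≡just : ∀ {p γ} → swapped p ≡ just γ →
                     (S p × c p ≡ just (transpose β α γ)) ⊎ (¬ S p × c p ≡ just γ)
      swapped≡just {p} {γ} eq with S? p | c p
      ... | yes Sp | just γ′ = inj₁ (Sp , cong just (begin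
        γ′                                 ≡⟨ transpose-inverse β α ⟨
        transpose β α (transpose α β γ′)   ≡⟨ cong (transpose β α) (just-injective eq) ⟩
        transpose β α γ                    ∎))
        where open ≡-Reasoning
      ... | no ¬Sp | _ = inj₂ (¬Sp , eq)

      ⊑-swapped : c ⊑ swapped
      ⊑-swapped p (γ , cp) with S? p
      ... | yes _ = transpose α β γ , cong (Maybe.map (transpose α β)) cp
      ... | no _  = γ , cp

      transpose-ColouredIn : ∀ {p q γ} → c p ≡ just (transpose β α γ) → ColouredIn p →
                             c q ≡ just γ → ColouredIn q
      transpose-ColouredIn {γ = γ} cp (inj₁ cpα) cq = inj₂ (trans cq (cong just (begin
        γ                                 ≡⟨ transpose-inverse α β ⟨
        transpose α β (transpose β α γ)   ≡⟨ cong (transpose α β) (just-injective (trans (sym cp) cpα)) ⟩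
        transpose α β α                   ≡⟨ transpose-matchˡ α β ⟩
        β                                 ∎)))
        where open ≡-Reasoning
      transpose-ColouredIn {γ = γ} cp (inj₂ cpβ) cq = inj₁ (trans cq (cong just (begin
        γ                                 ≡⟨ transpose-inverse α β ⟨
        transpose α β (transpose β α γ)   ≡⟨ cong (transpose α β) (just-injective (trans (sym cp) cpβ)) ⟩
        transpose α β β                   ≡⟨ transpose-matchʳ α β ⟩
        α                                 ∎)))
        where open ≡-Reasoning

      module _ {end} (proper : ProperAt end c) (closed : ClosedAt end S)
               (S⇒αβ : ∀ {p} → S p → ColouredIn p) where

        swapped-mixed : ∀ {p q γ} → S p → c p ≡ just (transpose β α γ) → ¬ S q → c q ≡ just γ →
                        end p ≡ end q → p ≡ q
        swapped-mixed {p} {q} Sp cp ¬Sq cq ep≡eq with q ≟ₑ p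
        ... | yes q≡p = sym q≡p
        ... | no q≢p  = contradiction (closed Sp ep≡eq q≢p (transpose-ColouredIn cp (S⇒αβ Sp) cq)) ¬Sq

        swapped-properAt : ProperAt end swapped
        swapped-properAt ep≡eq sp sq with swapped≡just sp | swapped≡just sq
        ... | inj₁ (_ , cp)   | inj₁ (_ , cq)   = proper ep≡eq cp cq
        ... | inj₂ (_ , cp)   | inj₂ (_ , cq)   = proper ep≡eq cp cq
        ... | inj₁ (Sp , cp)  | inj₂ (¬Sq , cq) = swapped-mixed Sp cp ¬Sq cq ep≡eq
        ... | inj₂ (¬Sp , cp) | inj₁ (Sq , cq)  = sym (swapped-mixed Sq cq ¬Sp cp (sym ep≡eq))

  -- The Kempe chain is the α/β-alternating
  -- path that starts with the α-edge at the target of e; it never reaches the source of e, so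
  -- swapping α and β along it makes α free at both ends of e.
  module KempeStep {c : Colouring} (proper : Proper c) {e : Edge} (ce≡nothing : c e ≡ nothing) where

    α β : Fin m
    α = proj₁ (freeAtSrc {c} {e} ce≡nothing)
    β = proj₁ (freeAtTgt {c} {e} ce≡nothing)

    α-free : ∀ p → src p ≡ src e → c p ≢ just α
    α-free = proj₂ (freeAtSrc {c} {e} ce≡nothing)

    β-free : ∀ p → tgt p ≡ tgt e → c p ≢ just β
    β-free = proj₂ (freeAtTgt {c} {e} ce≡nothing)

    open Recolour c α β

    data Chain : Edge → Set where
      start  : ∀ {p} → c p ≡ just α → tgt p ≡ tgt e → Chain p
      viaSrc : ∀ {p q} → Chain p → c p ≡ just α → c q ≡ just β → src p ≡ src q → Chain q
      viaTgt : ∀ {p q} → Chain p → c p ≡ just β → c q ≡ just α → tgt p ≡ tgt q → Chain q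

    chain-colours : ∀ {p} → Chain p → ColouredIn p
    chain-colours (start cp _)      = inj₁ cp
    chain-colours (viaSrc _ _ cq _) = inj₂ cq
    chain-colours (viaTgt _ _ cq _) = inj₁ cq

    chain-avoids-src : ∀ {p} → Chain p → src p ≢ src e
    chain-avoids-src (start cp _)            sp≡se = α-free _ sp≡se cp
    chain-avoids-src (viaSrc _ cp′ _ sp′≡sp) sp≡se = α-free _ (trans sp′≡sp sp≡se) cp′
    chain-avoids-src (viaTgt _ _ cp _)       sp≡se = α-free _ sp≡se cp

    chain-backSrc : ∀ {p q} → Chain p → c p ≡ just β → c q ≡ just α → src p ≡ src q → Chain q
    chain-backSrc r@(start cp _)          _ cq sp≡sq = subst Chain (proj₁ proper sp≡sq cp cq) r
    chain-backSrc (viaSrc r cp′ _ sp′≡sp) _ cq sp≡sq =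
      subst Chain (proj₁ proper (trans sp′≡sp sp≡sq) cp′ cq) r
    chain-backSrc r@(viaTgt _ _ cp _)     _ cq sp≡sq = subst Chain (proj₁ proper sp≡sq cp cq) r

    chain-backTgt : ∀ {p q} → Chain p → c p ≡ just α → c q ≡ just β → tgt p ≡ tgt q → Chain q
    chain-backTgt (start _ tp≡te)         _ cq tp≡tq = contradiction cq (β-free _ (trans (sym tp≡tq) tp≡te))
    chain-backTgt r@(viaSrc _ _ cp _)     _ cq tp≡tq = subst Chain (proj₂ proper tp≡tq cp cq) r
    chain-backTgt (viaTgt r cp′ _ tp′≡tp) _ cq tp≡tq =
      subst Chain (proj₂ proper (trans tp′≡tp tp≡tq) cp′ cq) r

    chain-closedAt-src : ClosedAt src Chain
    chain-closedAt-src r sp≡sq q≢p cq with chain-colours r | cq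
    ... | inj₁ cpα | inj₁ cqα = contradiction (sym (proj₁ proper sp≡sq cpα cqα)) q≢p
    ... | inj₁ cpα | inj₂ cqβ = viaSrc r cpα cqβ sp≡sq
    ... | inj₂ cpβ | inj₁ cqα = chain-backSrc r cpβ cqα sp≡sq
    ... | inj₂ cpβ | inj₂ cqβ = contradiction (sym (proj₁ proper sp≡sq cpβ cqβ)) q≢p

    chain-closedAt-tgt : ClosedAt tgt Chain
    chain-closedAt-tgt r tp≡tq q≢p cq with chain-colours r | cq
    ... | inj₁ cpα | inj₁ cqα = contradiction (sym (proj₂ proper tp≡tq cpα cqα)) q≢p
    ... | inj₁ cpα | inj₂ cqβ = chain-backTgt r cpα cqβ tp≡tq
    ... | inj₂ cpβ | inj₁ cqα = viaTgt r cpβ cqα tp≡tq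
    ... | inj₂ cpβ | inj₂ cqβ = contradiction (sym (proj₂ proper tp≡tq cpβ cqβ)) q≢p

    module _ (chain? : Decidable Chain) where

      open Swap chain?

      α-unused-at-src : ∀ q → src q ≡ src e → swapped q ≢ just α
      α-unused-at-src q sq≡se sq with swapped≡just sq
      ... | inj₁ (chain , _) = chain-avoids-src chain sq≡se
      ... | inj₂ (_ , cq)    = α-free q sq≡se cq

      α-unused-at-tgt : ∀ q → tgt q ≡ tgt e → swapped q ≢ just α
      α-unused-at-tgt q tq≡te sq with swapped≡just sq
      ... | inj₁ (_ , cq)      = β-free q tq≡te (trans cq (cong just (transpose-matchʳ β α)))
      ... | inj₂ (¬chain , cq) = ¬chain (start cq tq≡te)

      recoloured : Colouring
      recoloured = swapped [ e ≔ α ]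

      recoloured-proper : Proper recoloured
      recoloured-proper =
        update-properAt (swapped-properAt (proj₁ proper) chain-closedAt-src chain-colours) α-unused-at-src ,
        update-properAt (swapped-properAt (proj₂ proper) chain-closedAt-tgt chain-colours) α-unused-at-tgt

      e-recoloured : Coloured recoloured e
      e-recoloured = update-coloured swapped e α

      ⊑-recoloured : c ⊑ recoloured
      ⊑-recoloured p = ⊑-update swapped e α p ∘ ⊑-swapped p

  kempe-step : ∀ {c} → Proper c → ∀ {e} → c e ≡ nothing →
               ¬ ¬ (∃ λ c′ → Proper c′ × Coloured c′ e × c ⊑ c′)
  kempe-step proper ce≡nothing = do
    chain? ← ¬¬-∀-Fin λ a → ¬¬-∀-Fin λ i → ¬¬-excluded-middle
    let open KempeStep proper ce≡nothing
    pure (recoloured (uncurry chain?) , recoloured-proper (uncurry chain?) ,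
          e-recoloured (uncurry chain?) , ⊑-recoloured (uncurry chain?))

  colour-edge : ∀ {c} → Proper c → ∀ e → ¬ ¬ (∃ λ c′ → Proper c′ × Coloured c′ e × c ⊑ c′)
  colour-edge {c} proper e with c e in ce
  ... | just γ  = pure (c , proper , (γ , ce) , ⊑-refl)
  ... | nothing = kempe-step proper ce

  colour-all : (es : List Edge) → ¬ ¬ (∃ λ c → Proper c × ListAll.All (Coloured c) es)
  colour-all []       = pure (uncoloured , uncoloured-proper , ListAll.[])
  colour-all (e ∷ es) = do
    c , proper , done ← colour-all es
    c′ , proper′ , e-done , c⊑c′ ← colour-edge proper e
    pure (c′ , proper′ , e-done ListAll.∷ ListAll.map (c⊑c′ _) done)

  Separates : (Edge → Fin k) → (Edge → Fin m) → Set
  Separates end κ = ∀ p q → end p ≡ end q → κ p ≡ κ q → p ≡ q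

  EdgeColouring : (Edge → Fin m) → Set
  EdgeColouring κ = Separates src κ × Separates tgt κ

  total⇒edgeColouring : ∀ {c} → Proper c → (∀ e → Coloured c e) → ∃ EdgeColouring
  total⇒edgeColouring {c} (properₛ , properₜ) coloured =
    proj₁ ∘ coloured , separates properₛ , separates properₜ
    where
    separates : ∀ {end} → ProperAt end c → Separates end (proj₁ ∘ coloured)
    separates proper p q ep≡eq κp≡κq =
      proper ep≡eq (proj₂ (coloured p)) (trans (proj₂ (coloured q)) (cong just (sym κp≡κq)))

  ∀-Edge? : {P : Edge → Set} → Decidable P → Dec (∀ p → P p)
  ∀-Edge? P? = map′ (λ h (a , i) → h a i) (λ h a i → h (a , i)) (all? λ a → all? λ i → P? (a , i))

  separates? : ∀ end κ → Dec (Separates end κ)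
  separates? end κ = ∀-Edge? λ p → ∀-Edge? λ q → (end p ≟ end q) →-dec (κ p ≟ κ q) →-dec (p ≟ₑ q)

  separates-resp : ∀ {end κ κ′} → κ ≗ κ′ → Separates end κ → Separates end κ′
  separates-resp κ≗κ′ sep p q ep≡eq κ′p≡κ′q =
    sep p q ep≡eq (trans (κ≗κ′ p) (trans κ′p≡κ′q (sym (κ≗κ′ q))))

  fromTable : Vec (Fin m) (m * k) → Edge → Fin m
  fromTable v (a , i) = lookup v (combine a i)

  fromTable-tabulate : ∀ κ → fromTable (tabulate (κ ∘ remQuot k)) ≗ κ
  fromTable-tabulate κ (a , i) =
    trans (lookup∘tabulate (κ ∘ remQuot k) (combine a i)) (cong κ (remQuot-combine a i))

  edgeColouring? : Dec (∃ EdgeColouring)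
  edgeColouring? = map′ (λ (v , ok) → fromTable v , ok) tabulated
    (∃-Vec? (m * k) λ v → separates? src (fromTable v) ×-dec separates? tgt (fromTable v))
    where
    tabulated : ∃ EdgeColouring → ∃ λ v → EdgeColouring (fromTable v)
    tabulated (κ , sepₛ , sepₜ) = tabulate (κ ∘ remQuot k) ,
      separates-resp (sym ∘ fromTable-tabulate κ) sepₛ , separates-resp (sym ∘ fromTable-tabulate κ) sepₜ

  edgeColouring : ∃ EdgeColouring
  edgeColouring = decidable-stable edgeColouring? (do
    c , proper , done ← colour-all (cartesianProduct (allFin m) (allFin k))
    pure (total⇒edgeColouring proper λ (a , i) →
      ListAll.lookup done (∈-cartesianProduct⁺ (∈-allFin a) (∈-allFin i))))

  module FromEdgeColouring {κ : Edge → Fin m} (colouring : EdgeColouring κ) where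

    first : Fin k → Permutation′ m
    first i = injective⇒permutation (λ a → κ (a , i)) (λ eq → cong proj₁ (proj₁ colouring _ _ refl eq))

    edgeOf : Fin m → Fin k → Edge
    edgeOf b i = first i ⟨$⟩ˡ b , i

    κ-edgeOf : ∀ b i → κ (edgeOf b i) ≡ b
    κ-edgeOf b i = inverseʳ (first i)

    edgeOf-first : ∀ a i → edgeOf (first i ⟨$⟩ʳ a) i ≡ (a , i)
    edgeOf-first a i = cong (_, i) (inverseˡ (first i))

    middle : Fin m → Permutation′ k
    middle b = injective⇒permutation (λ i → tgt (edgeOf b i))
      (λ eq → cong proj₂ (proj₂ colouring _ _ eq (trans (κ-edgeOf b _) (sym (κ-edgeOf b _)))))

    arriving : Fin k → Fin m → Edge
    arriving j b = edgeOf b (middle b ⟨$⟩ˡ j)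

    arriving-injective : ∀ j {b b′} → proj₁ (to (arriving j b)) ≡ proj₁ (to (arriving j b′)) → b ≡ b′
    arriving-injective j {b} {b′} eq = begin
      b                  ≡⟨ κ-edgeOf b _ ⟨
      κ (arriving j b)   ≡⟨ cong κ (Injection.injective (Inverse⇒Injection σ) (cong₂ _,_ eq same-tgt)) ⟩
      κ (arriving j b′)  ≡⟨ κ-edgeOf b′ _ ⟩
      b′                 ∎
      where
      open ≡-Reasoning
      same-tgt : tgt (arriving j b) ≡ tgt (arriving j b′)
      same-tgt = trans (inverseʳ (middle b)) (sym (inverseʳ (middle b′)))

    last : Fin k → Permutation′ m
    last j = injective⇒permutation (λ b → proj₁ (to (arriving j b))) (arriving-injective j)

    factorises : ∀ p → to p ≡ columnwise last (rowwise middle (columnwise first p))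
    factorises (a , i) = cong₂ _,_ (cong (proj₁ ∘ to) (sym arrives-at-p)) (cong tgt (sym (edgeOf-first a i)))
      where
      b : Fin m
      b = first i ⟨$⟩ʳ a
      arrives-at-p : arriving (middle b ⟨$⟩ʳ i) b ≡ (a , i)
      arrives-at-p = trans (cong (edgeOf b) (inverseˡ (middle b))) (edgeOf-first a i)

  -- Opaque, so that type checking never unfolds the exhaustive search behind edgeColouring.
  opaque
    columnRowColumn : ColumnRowColumn to
    columnRowColumn = record { FromEdgeColouring (proj₂ edgeColouring) }

-- Grids

open module GridSetoidProperties {d} {n} = Setoid (GridSetoid d n)
  using () renaming (refl to ≈-refl; sym to ≈-sym; trans to ≈-trans; reflexive to ≡⇒≈)

size : (d : ℕ) → (Fin d → ℕ) → ℕ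
size zero    n = 1
size (suc d) n = n zero * size d (n ∘ suc)

cons : ∀ {d} {n : Fin (suc d) → ℕ} → Fin (n zero) → Grid d (n ∘ suc) → Grid (suc d) n
cons a y zero    = a
cons a y (suc i) = y i

peelHead : ∀ {d} {n : Fin (suc d) → ℕ} {B : Set} → Inverse (GridSetoid d (n ∘ suc)) (≡.setoid B) →
           Inverse (GridSetoid (suc d) n) (≡.setoid (Fin (n zero) × B))
peelHead c = mkInverse (λ x → x zero , to (x ∘ suc)) (λ (a , b) → cons a (from b))
  (λ x≈y → cong₂ _,_ (x≈y zero) (to-cong (x≈y ∘ suc)))
  (λ { refl → ≈-refl })
  (λ (a , b) → cong (a ,_) (strictlyInverseˡ b))
  (λ x → λ { zero → refl ; (suc i) → strictlyInverseʳ (x ∘ suc) i })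
  where open Inverse c

code : ∀ {d n} → Inverse (GridSetoid d n) (≡.setoid (Fin (size d n)))
code {zero}  = mkInverse (λ _ → zero) (λ _ ()) (λ _ → refl) (λ _ ()) (λ { zero → refl }) (λ _ ())
code {suc d} = Compose.inverse (peelHead code) (Symmetry.inverse *↔×)

code-injective : ∀ {d n} → Injective _≈G_ _≡_ (Inverse.to (code {d} {n}))
code-injective = Injection.injective (Inverse⇒Injection code)

MovesOnly : ∀ {d n} → Fin d → Perm d n → Set
MovesOnly i τ = ∀ x j → j ≢ i → Inverse.to τ x j ≡ x j

composite : ∀ {d n L} → Vec (Perm d n) L → Grid d n → Grid d n
composite τs = composeAll (map Inverse.to τs)

composite-[] : ∀ {d n} (τs : Vec (Perm d n) 0) x → composite τs x ≡ x
composite-[] [] x = refl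

composite-head-tail : ∀ {d n L} (τs : Vec (Perm d n) (suc L)) x →
                      Inverse.to (head τs) (composite (tail τs) x) ≡ composite τs x
composite-head-tail (τ ∷ τs) x = refl

composite-∷ʳ : ∀ {d n L} (τs : Vec (Perm d n) L) τ x →
               composite (τs ∷ʳ τ) x ≡ composite τs (Inverse.to τ x)
composite-∷ʳ []        τ x = refl
composite-∷ʳ (τ′ ∷ τs) τ x = cong (Inverse.to τ′) (composite-∷ʳ τs τ x)

composite-++ : ∀ {d n L M} (τs : Vec (Perm d n) L) (τs′ : Vec (Perm d n) M) x →
               composite (τs ++ τs′) x ≡ composite τs (composite τs′ x)
composite-++ []       τs′ x = refl
composite-++ (τ ∷ τs) τs′ x = cong (Inverse.to τ) (composite-++ τs τs′ x)

composite-injective : ∀ {d n L} (τs : Vec (Perm d n) L) → Injective _≈G_ _≈G_ (composite τs)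
composite-injective []       eq = eq
composite-injective (τ ∷ τs) eq = composite-injective τs (Injection.injective (Inverse⇒Injection τ) eq)

DecomposesAlong : ∀ {d n L} → Vec (Fin d) L → Perm d n → Set
DecomposesAlong {d} {n} {L} is σ =
  Σ[ τs ∈ Vec (Perm d n) L ]
    (Pointwise (MovesOnly {d} {n}) is τs × ∀ x → Inverse.to σ x ≈G composite τs x)

module _ {d : ℕ} {n : Fin (suc d) → ℕ} where

  columns : Inverse (GridSetoid (suc d) n) (≡.setoid (Fin (n zero) × Fin (size d (n ∘ suc))))
  columns = peelHead code

  permuteHead : (Fin (size d (n ∘ suc)) → Permutation′ (n zero)) → Perm (suc d) n
  permuteHead π = conjugate columns (columnwise↔ π)

  permuteHead-movesOnly : ∀ π → MovesOnly zero (permuteHead π)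
  permuteHead-movesOnly π x zero    0≢0 = contradiction refl 0≢0
  permuteHead-movesOnly π x (suc j) _   = Inverse.strictlyInverseʳ code (x ∘ suc) j

  layered : (Fin (n zero) → Grid d (n ∘ suc) → Grid d (n ∘ suc)) → Grid (suc d) n → Grid (suc d) n
  layered f x = cons (x zero) (f (x zero) (x ∘ suc))

  layered-cong : ∀ {f g} → (∀ a {y y′ : Grid d (n ∘ suc)} → y ≈G y′ → f a y ≈G g a y′) →
                 ∀ {x x′ : Grid (suc d) n} → x ≈G x′ → layered f x ≈G layered g x′
  layered-cong f≈g x≈x′ zero = x≈x′ zero
  layered-cong {g = g} f≈g {x} {x′} x≈x′ (suc i) =
    trans (f≈g (x zero) (x≈x′ ∘ suc) i) (cong (λ a → g a (x′ ∘ suc) i) (x≈x′ zero))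

  layer : (Fin (n zero) → Perm d (n ∘ suc)) → Perm (suc d) n
  layer ρ = mkInverse (layered (Inverse.to ∘ ρ)) (layered (Inverse.from ∘ ρ))
    (layered-cong (Inverse.to-cong ∘ ρ)) (layered-cong (Inverse.from-cong ∘ ρ))
    (λ x → λ { zero → refl ; (suc i) → Inverse.strictlyInverseˡ (ρ (x zero)) (x ∘ suc) i })
    (λ x → λ { zero → refl ; (suc i) → Inverse.strictlyInverseʳ (ρ (x zero)) (x ∘ suc) i })

  layer-movesOnly : ∀ {ρ i} → (∀ a → MovesOnly i (ρ a)) → MovesOnly (suc i) (layer ρ)
  layer-movesOnly moves x zero    _     = refl
  layer-movesOnly moves x (suc j) sj≢si = moves (x zero) (x ∘ suc) j (sj≢si ∘ cong suc)

  record HeadLayerHead (σ : Perm (suc d) n) : Set where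
    field
      first last      : Perm (suc d) n
      first-movesOnly : MovesOnly zero first
      last-movesOnly  : MovesOnly zero last
      slices          : Fin (n zero) → Perm d (n ∘ suc)
      factorises      : ∀ x → Inverse.to σ x ≈G
                              Inverse.to last (Inverse.to (layer slices) (Inverse.to first x))

  headLayerHead : (σ : Perm (suc d) n) → HeadLayerHead σ
  headLayerHead σ = record
    { first           = permuteHead F.first
    ; last            = permuteHead F.last
    ; first-movesOnly = permuteHead-movesOnly F.first
    ; last-movesOnly  = permuteHead-movesOnly F.last
    ; slices          = conjugate code ∘ F.middle
    ; factorises      = factorises
    }
    where
    σ′ : (Fin (n zero) × Fin (size d (n ∘ suc))) ↔ (Fin (n zero) × Fin (size d (n ∘ suc)))
    σ′ = conjugate (Symmetry.inverse columns) σ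
    module F = ColumnRowColumn (Kőnig.columnRowColumn σ′)
    open Inverse columns
    factorises : ∀ x → Inverse.to σ x ≈G
                       from (columnwise F.last (to (from (rowwise F.middle (to (from (columnwise F.first (to x))))))))
    factorises x = begin
      Inverse.to σ x                                        ≈⟨ Inverse.to-cong σ (strictlyInverseʳ x) ⟨
      Inverse.to σ (from (to x))                            ≈⟨ strictlyInverseʳ _ ⟨
      from (Inverse.to σ′ (to x))                           ≡⟨ cong from (F.factorises (to x)) ⟩
      from (columnwise F.last (rowwise F.middle (columnwise F.first (to x))))
        ≡⟨ cong (from ∘ columnwise F.last) to∘from ⟨
      from (columnwise F.last (to (from (rowwise F.middle (to (from (columnwise F.first (to x))))))))  ∎
      where
      open SetoidReasoning (GridSetoid (suc d) n)
      to∘from : to (from (rowwise F.middle (to (from (columnwise F.first (to x)))))) ≡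
                rowwise F.middle (columnwise F.first (to x))
      to∘from = trans (strictlyInverseˡ _) (cong (rowwise F.middle) (strictlyInverseˡ _))

  layers : ∀ {L} → (Fin (n zero) → Vec (Perm d (n ∘ suc)) L) → Vec (Perm (suc d) n) L
  layers {zero}  τs = []
  layers {suc L} τs = layer (head ∘ τs) ∷ layers (tail ∘ τs)

  layers-composite : ∀ {L} (τs : Fin (n zero) → Vec (Perm d (n ∘ suc)) L) x →
                     composite (layers τs) x ≈G layered (λ a → composite (τs a)) x
  layers-composite {zero}  τs x zero    = refl
  layers-composite {zero}  τs x (suc i) = cong (λ y → y i) (sym (composite-[] (τs (x zero)) (x ∘ suc)))
  layers-composite {suc L} τs x =
    ≈-trans (Inverse.to-cong (layer (head ∘ τs)) (layers-composite (tail ∘ τs) x)) head-tail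
    where
    head-tail : layered (λ a → Inverse.to (head (τs a)) ∘ composite (tail (τs a))) x ≈G
                layered (λ a → composite (τs a)) x
    head-tail zero    = refl
    head-tail (suc i) = cong (λ y → y i) (composite-head-tail (τs (x zero)) (x ∘ suc))

  layers-movesOnly : ∀ {L} (is : Vec (Fin d) L) (τs : Fin (n zero) → Vec (Perm d (n ∘ suc)) L) →
                     (∀ a → Pointwise (MovesOnly {d} {n ∘ suc}) is (τs a)) →
                     Pointwise (MovesOnly {suc d} {n}) (map suc is) (layers τs)
  layers-movesOnly []       τs moves = []
  layers-movesOnly (i ∷ is) τs moves =
    layer-movesOnly {ρ = head ∘ τs} (proj₁ ∘ uncons) ∷ layers-movesOnly is (tail ∘ τs) (proj₂ ∘ uncons)
    where
    uncons : ∀ a → MovesOnly i (head (τs a)) × Pointwise (MovesOnly {d} {n ∘ suc}) is (tail (τs a))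
    uncons a = Pointwise-uncons (τs a) (moves a)

  layer-decomposesAlong : ∀ {L} {is : Vec (Fin d) L} (ρ : Fin (n zero) → Perm d (n ∘ suc)) →
                          (∀ a → DecomposesAlong is (ρ a)) → DecomposesAlong (map suc is) (layer ρ)
  layer-decomposesAlong {L} {is} ρ decomposes =
    layers τs , layers-movesOnly is τs (proj₁ ∘ proj₂ ∘ decomposes) ,
    λ x → ≈-trans (layered-cong slice≈composite (≈-refl {x = x})) (≈-sym (layers-composite τs x))
    where
    τs : Fin (n zero) → Vec (Perm d (n ∘ suc)) L
    τs = proj₁ ∘ decomposes
    slice≈composite : ∀ a {y y′} → y ≈G y′ → Inverse.to (ρ a) y ≈G composite (τs a) y′
    slice≈composite a y≈y′ = ≈-trans (Inverse.to-cong (ρ a) y≈y′) (proj₂ (proj₂ (decomposes a)) _)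

-- Upper bound

palindromeLength : ℕ → ℕ
palindromeLength zero    = 1
palindromeLength (suc d) = 2 + palindromeLength d

palindrome : (d : ℕ) → Vec (Fin (suc d)) (palindromeLength d)
palindrome zero    = zero ∷ []
palindrome (suc d) = zero ∷ (map suc (palindrome d) ∷ʳ zero)

decomposesAlong-palindrome : ∀ d {n : Fin (suc d) → ℕ} (σ : Perm (suc d) n) →
                             DecomposesAlong (palindrome d) σ
decomposesAlong-palindrome zero σ = σ ∷ [] , movesOnly-zero ∷ [] , λ _ → ≈-refl
  where
  movesOnly-zero : MovesOnly zero σ
  movesOnly-zero x zero 0≢0 = contradiction refl 0≢0
decomposesAlong-palindrome (suc d) {n} σ =
  last ∷ (τs ∷ʳ first) , last-movesOnly ∷ Pointwise-∷ʳ (proj₁ (proj₂ lifted)) first-movesOnly , factorisation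
  where
  open HeadLayerHead (headLayerHead {suc d} {n} σ)
  lifted : DecomposesAlong (map suc (palindrome d)) (layer {n = n} slices)
  lifted = layer-decomposesAlong slices (λ a → decomposesAlong-palindrome d (slices a))
  τs : Vec (Perm (suc (suc d)) n) (palindromeLength d)
  τs = proj₁ lifted
  factorisation : ∀ x → Inverse.to σ x ≈G composite (last ∷ (τs ∷ʳ first)) x
  factorisation x = begin
    Inverse.to σ x
      ≈⟨ factorises x ⟩
    Inverse.to last (Inverse.to (layer slices) (Inverse.to first x))
      ≈⟨ Inverse.to-cong last (proj₂ (proj₂ lifted) _) ⟩
    Inverse.to last (composite τs (Inverse.to first x))
      ≡⟨ cong (Inverse.to last) (composite-∷ʳ τs first x) ⟨
    Inverse.to last (composite (τs ∷ʳ first) x)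
      ∎
    where open SetoidReasoning (GridSetoid (suc (suc d)) n)

movesOnly⇒oneDim : ∀ {d n L} {is : Vec (Fin d) L} {τs : Vec (Perm d n) L} →
                   Pointwise MovesOnly is τs → All OneDim τs
movesOnly⇒oneDim []             = []
movesOnly⇒oneDim (moves ∷ rest) = (_ , moves) ∷ movesOnly⇒oneDim rest

2*[1+d]∸1≡1+d+d : ∀ d → 2 * suc d ∸ 1 ≡ suc (d + d)
2*[1+d]∸1≡1+d+d d = trans (+-suc d (d + 0)) (cong (λ m → suc (d + m)) (+-identityʳ d))

palindromeLength≡1+d+d : ∀ d → palindromeLength d ≡ suc (d + d)
palindromeLength≡1+d+d zero    = refl
palindromeLength≡1+d+d (suc d) = cong (2 +_) (trans (palindromeLength≡1+d+d d) (sym (+-suc d d)))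

oneDimDecomposition : ∀ d n (σ : Perm d n) → OneDimDecomposition (2 * d ∸ 1) σ
oneDimDecomposition zero    n σ = [] , [] , λ x ()
oneDimDecomposition (suc d) n σ with decomposesAlong-palindrome d σ
... | τs , moves , factorisation =
  subst (λ L → OneDimDecomposition L σ) (trans (palindromeLength≡1+d+d d) (sym (2*[1+d]∸1≡1+d+d d)))
    (τs , movesOnly⇒oneDim moves , factorisation)

-- Lower bound

swapPoints : ∀ {d n} → Grid d n → Grid d n → Perm d n
swapPoints z o = conjugate code (Permutation.transpose (Inverse.to code z) (Inverse.to code o))

swapPoints-sends : ∀ {d n} (z o : Grid d n) → Inverse.to (swapPoints z o) z ≈G o
swapPoints-sends z o =
  ≈-trans (Inverse.from-cong code (transpose-matchˡ (Inverse.to code z) (Inverse.to code o)))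
          (Inverse.strictlyInverseʳ code o)

swapPoints-fixes : ∀ {d n} {z o y : Grid d n} → ¬ y ≈G z → ¬ y ≈G o → Inverse.to (swapPoints z o) y ≈G y
swapPoints-fixes {y = y} y≉z y≉o =
  ≈-trans (Inverse.from-cong code (transpose-other (y≉z ∘ code-injective) (y≉o ∘ code-injective)))
          (Inverse.strictlyInverseʳ code y)

module _ {d n} {z o : Grid d n} (apart : ∀ i → z i ≢ o i) (U V : Grid d n → Grid d n) {i j : Fin d}
         (factorises : ∀ x → Inverse.to (swapPoints z o) x ≈G U (V x))
         (U-fixes : ∀ x → U x j ≡ x j) (V-fixes : ∀ x → V x i ≡ x i)
         (V-injective : Injective _≈G_ _≈G_ V) where

  private
    σ : Perm d n
    σ = swapPoints z o

  Marked : Grid d n → Set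
  Marked y = y i ≡ z i × Inverse.to σ y j ≡ o j

  marked? : ∀ y → Dec (Marked y)
  marked? y = (y i ≟ z i) ×-dec (Inverse.to σ y j ≟ o j)

  marked-resp : ∀ {y y′} → y ≈G y′ → Marked y → Marked y′
  marked-resp y≈y′ (yᵢ , σyⱼ) = trans (sym (y≈y′ i)) yᵢ , trans (sym (Inverse.to-cong σ y≈y′ j)) σyⱼ

  z-marked : Marked z
  z-marked = refl , swapPoints-sends z o j

  V-marked : ∀ {y} → Marked y → V y i ≡ z i × V y j ≡ o j
  V-marked {y} (yᵢ , σyⱼ) = trans (V-fixes y) yᵢ , trans (sym (trans (factorises y j) (U-fixes (V y)))) σyⱼ

  V-preserves-marked : ∀ {y} → Marked y → Marked (V y)
  V-preserves-marked {y} marked = Vyᵢ , trans (swapPoints-fixes Vy≉z Vy≉o j) Vyⱼ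
    where
    Vyᵢ : V y i ≡ z i
    Vyᵢ = proj₁ (V-marked marked)
    Vyⱼ : V y j ≡ o j
    Vyⱼ = proj₂ (V-marked marked)
    Vy≉z : ¬ V y ≈G z
    Vy≉z Vy≈z = apart j (trans (sym (Vy≈z j)) Vyⱼ)
    Vy≉o : ¬ V y ≈G o
    Vy≉o Vy≈o = apart i (trans (sym Vyᵢ) (Vy≈o i))

  V-on-marked : Grid d n → Grid d n
  V-on-marked y with marked? y
  ... | yes _ = V y
  ... | no _  = y

  V-on-marked-injective : Injective _≈G_ _≈G_ V-on-marked
  V-on-marked-injective {y} {y′} eq with marked? y | marked? y′
  ... | yes _       | yes _       = V-injective eq
  ... | no _        | no _        = eq
  ... | yes marked  | no unmarked = contradiction (marked-resp eq (V-preserves-marked marked)) unmarked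
  ... | no unmarked | yes marked  = contradiction (marked-resp (≈-sym eq) (V-preserves-marked marked)) unmarked

  V-on-marked-misses-z : ∀ y → ¬ V-on-marked y ≈G z
  V-on-marked-misses-z y eq with marked? y
  ... | yes marked  = apart j (trans (sym (eq j)) (proj₂ (V-marked marked)))
  ... | no unmarked = unmarked (marked-resp (≈-sym eq) z-marked)

  swapPoints-not-split : ⊥
  swapPoints-not-split = uncurry V-on-marked-misses-z (finite-injective⇒surjective code V-on-marked-injective z)

Fixes : ∀ {d n} → Fin d → Perm d n → Set
Fixes j τ = ∀ x → Inverse.to τ x j ≡ x j

composite-fixes : ∀ {d n L j} {τs : Vec (Perm d n) L} → All (Fixes j) τs → ∀ x → composite τs x j ≡ x j
composite-fixes                []             x = refl
composite-fixes {τs = τ ∷ τs} (fixes ∷ rest) x = trans (fixes (composite τs x)) (composite-fixes rest x)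

short-composite-fixes : ∀ {d n L} {τs : Vec (Perm d n) L} → L < d → All OneDim τs →
                        ∃ λ j → ∀ x → composite τs x j ≡ x j
short-composite-fixes {τs = τs} L<d oneDim with <⇒∃-unhit L<d (λ t → proj₁ (lookup⁺ oneDim t))
... | j , unhit =
  j , composite-fixes {τs = τs} (lookup⁻ λ t x → proj₂ (lookup⁺ oneDim t) x j (unhit t ∘ sym))

zeros ones : ∀ {d} {n : Fin d → ℕ} → (∀ i → 2 ≤ n i) → Grid d n
zeros 2≤n i = fromℕ< (≤-trans (s≤s z≤n) (2≤n i))
ones  2≤n i = fromℕ< (2≤n i)

zeros≢ones : ∀ {d} {n : Fin d → ℕ} (2≤n : ∀ i → 2 ≤ n i) i → zeros 2≤n i ≢ ones 2≤n i
zeros≢ones 2≤n i eq = 0≢1+n (trans (sym (toℕ-fromℕ< _)) (trans (cong toℕ eq) (toℕ-fromℕ< (2≤n i))))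

no-short-decomposition : ∀ {d} {n : Fin (suc d) → ℕ} (2≤n : ∀ i → 2 ≤ n i) {p q} → p ≤ d → q ≤ d →
                         ¬ OneDimDecomposition (p + q) (swapPoints (zeros 2≤n) (ones 2≤n))
no-short-decomposition 2≤n {p} p≤d q≤d (τs , oneDim , factorises) with splitAt p τs
... | τs₁ , τs₂ , refl =
  swapPoints-not-split (zeros≢ones 2≤n) (composite τs₁) (composite τs₂)
    (λ x → ≈-trans (factorises x) (≡⇒≈ (composite-++ τs₁ τs₂ x)))
    (proj₂ (short-composite-fixes (s≤s p≤d) (++ˡ⁻ τs₁ oneDim)))
    (proj₂ (short-composite-fixes (s≤s q≤d) (++ʳ⁻ τs₁ oneDim)))
    (composite-injective τs₂)

swapPoints-lowerBound : ∀ d {n : Fin d → ℕ} (2≤n : ∀ i → 2 ≤ n i) k →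
                        OneDimDecomposition k (swapPoints (zeros 2≤n) (ones 2≤n)) → 2 * d ∸ 1 ≤ k
swapPoints-lowerBound zero    2≤n k _             = z≤n
swapPoints-lowerBound (suc d) 2≤n k decomposition = ≮⇒≥ λ k<2d+1 →
  no-short-decomposition 2≤n (m⊓n≤m d k) (m≤n+o⇒m∸n≤o k d (k≤d+d k<2d+1))
    (subst (λ L → OneDimDecomposition L (swapPoints (zeros 2≤n) (ones 2≤n)))
           (sym (m⊓n+n∸m≡n d k)) decomposition)
  where
  k≤d+d : k < 2 * suc d ∸ 1 → k ≤ d + d
  k≤d+d k<2d+1 = s≤s⁻¹ (subst (suc k ≤_) (2*[1+d]∸1≡1+d+d d) k<2d+1)

mainTheorem3 : (d : ℕ) (n : Fin d → ℕ)
    → ((σ : Perm d n) → OneDimDecomposition (2 * d ∸ 1) σ)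
      × ((∀ i → 2 ≤ n i)
         → Σ[ σ ∈ Perm d n ] ((k : ℕ) → OneDimDecomposition k σ → 2 * d ∸ 1 ≤ k))
mainTheorem3 d n =
  oneDimDecomposition d n ,
  λ 2≤n → swapPoints (zeros 2≤n) (ones 2≤n) , swapPoints-lowerBound d 2≤n
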